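{- Let $\delta,K_1,K_2,C_0,C_1$ be admissible parameters with $C'>C+1$ and let $M$ be a magic parameter. Then either $\mathcal{F}^C_x=\emptyset$ for all $x<M$, or the parameters satisfy Case (IIB). In the latter case, the only nonempty set $\mathcal{F}^C_x$ with $x<M$ is $\mathcal{F}^C_{M-1}=\{(\delta,\delta)\}$, and $t_M(M-1)>t_M(a)$ for every $a\in\{1,\dots,\delta\}\setminus\{M,M-1\}$.
   Context: Parameters $\delta,K_1,K_2,C_0,C_1$ are positive integers; acceptable if $3\le\delta<\infty$, $1\le K_1\le K_2\le\delta$, $2\delta+2\le C_0,C_1\le 3\delta+2$, $C_0$ even, $C_1$ odd. $C=\min(C_0,C_1)$, $C'=\max(C_0,C_1)$. Admissible: acceptable and either (II) $C\le 2\delta+K_1$, $C=2K_1+2K_2+1$, $K_1+K_2\ge\delta$, $K_1+2K_2\le 2\delta-1$, and either (IIA) $C'=C+1$ or (IIB) $C'>C+1$, $K_1=K_2$, $3K_2=2\delta-1$; or (III) $C\ge 2\delta+K_1+1$, $K_1+2K_2\ge 2\delta-1$, $3K_2\ge 2\delta$, if $K_1+2K_2=2\delta-1$ then $C\ge 2\delta+K_1+2$, and if $C'>C+1$ then $C\ge 2\delta+K_2$. A magic distance is $M$ with $\max(K_1,\lceil\delta/2\rceil)\le M\le\min(K_2,\lfloor(C-\delta-1)/2\rfloor)$; a magic parameter is a magic distance such that additionally: if Case (III) holds and $K_1+2K_2=2\delta-1$ then $M>K_1$; if Case (III) holds, $C'>C+1$ and $C=2\delta+K_2$, then $M<K_2$.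 For $x\in\{1,\dots,\delta\}$, $\mathcal{F}^C_x=\{(a,b)\in\{1,\dots,\delta\}^2:C-1-a-b=x\}$. For $x\in\{1,\dots,\delta\}\setminus\{M\}$, $t_M(x)=2x-1$ if $x<M$ and $t_M(x)=2(\delta-x)$ if $x>M$. -}

module Defs where

import Data.Bool
open import Data.Nat using (_<ᵇ_; ℕ; _+_; _*_; _∸_; _≤_; _<_; _⊓_; _⊔_; ⌊_/2⌋; ⌈_/2⌉)
open import Data.Nat.Divisibility using (_∣_)
open import Data.Product using (_×_)
open import Data.Sum using (_⊎_)
open import Relation.Nullary using (¬_)
open import Relation.Binary.PropositionalEquality using (_≡_)

Cmin : ℕ → ℕ → ℕ
Cmin C₀ C₁ = C₀ ⊓ C₁

Cmax : ℕ → ℕ → ℕ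
Cmax C₀ C₁ = C₀ ⊔ C₁

Acceptable : ℕ → ℕ → ℕ → ℕ → ℕ → Set
Acceptable δ K₁ K₂ C₀ C₁ =
  3 ≤ δ × 1 ≤ K₁ × K₁ ≤ K₂ × K₂ ≤ δ ×
  2 * δ + 2 ≤ C₀ × C₀ ≤ 3 * δ + 2 ×
  2 * δ + 2 ≤ C₁ × C₁ ≤ 3 * δ + 2 ×
  2 ∣ C₀ × ¬ (2 ∣ C₁)

CaseIIbase : ℕ → ℕ → ℕ → ℕ → ℕ → Set
CaseIIbase δ K₁ K₂ C₀ C₁ =
  Cmin C₀ C₁ ≤ 2 * δ + K₁ ×
  Cmin C₀ C₁ ≡ 2 * K₁ + 2 * K₂ + 1 ×
  δ ≤ K₁ + K₂ ×
  K₁ + 2 * K₂ ≤ 2 * δ ∸ 1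

CaseIIA : ℕ → ℕ → ℕ → ℕ → ℕ → Set
CaseIIA δ K₁ K₂ C₀ C₁ =
  CaseIIbase δ K₁ K₂ C₀ C₁ × Cmax C₀ C₁ ≡ Cmin C₀ C₁ + 1

CaseIIB : ℕ → ℕ → ℕ → ℕ → ℕ → Set
CaseIIB δ K₁ K₂ C₀ C₁ =
  CaseIIbase δ K₁ K₂ C₀ C₁ ×
  Cmin C₀ C₁ + 1 < Cmax C₀ C₁ × K₁ ≡ K₂ × 3 * K₂ ≡ 2 * δ ∸ 1

CaseII : ℕ → ℕ → ℕ → ℕ → ℕ → Set
CaseII δ K₁ K₂ C₀ C₁ = CaseIIA δ K₁ K₂ C₀ C₁ ⊎ CaseIIB δ K₁ K₂ C₀ C₁

CaseIII : ℕ → ℕ → ℕ → ℕ → ℕ → Set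
CaseIII δ K₁ K₂ C₀ C₁ =
  2 * δ + K₁ + 1 ≤ Cmin C₀ C₁ ×
  2 * δ ∸ 1 ≤ K₁ + 2 * K₂ ×
  2 * δ ≤ 3 * K₂ ×
  (K₁ + 2 * K₂ ≡ 2 * δ ∸ 1 → 2 * δ + K₁ + 2 ≤ Cmin C₀ C₁) ×
  (Cmin C₀ C₁ + 1 < Cmax C₀ C₁ → 2 * δ + K₂ ≤ Cmin C₀ C₁)

Admissible : ℕ → ℕ → ℕ → ℕ → ℕ → Set
Admissible δ K₁ K₂ C₀ C₁ =
  Acceptable δ K₁ K₂ C₀ C₁ × (CaseII δ K₁ K₂ C₀ C₁ ⊎ CaseIII δ K₁ K₂ C₀ C₁)

MagicDistance : ℕ → ℕ → ℕ → ℕ → ℕ → ℕ → Set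
MagicDistance δ K₁ K₂ C₀ C₁ M =
  K₁ ≤ M × ⌈ δ /2⌉ ≤ M × M ≤ K₂ × M ≤ ⌊ Cmin C₀ C₁ ∸ δ ∸ 1 /2⌋

MagicParameter : ℕ → ℕ → ℕ → ℕ → ℕ → ℕ → Set
MagicParameter δ K₁ K₂ C₀ C₁ M =
  MagicDistance δ K₁ K₂ C₀ C₁ M ×
  (CaseIII δ K₁ K₂ C₀ C₁ → K₁ + 2 * K₂ ≡ 2 * δ ∸ 1 → K₁ < M) ×
  (CaseIII δ K₁ K₂ C₀ C₁ → Cmin C₀ C₁ + 1 < Cmax C₀ C₁ →
     Cmin C₀ C₁ ≡ 2 * δ + K₂ → M < K₂)

-- (a , b) ∈ F^C_x  :  a, b ∈ {1..δ} and C - 1 - a - b = x  (as integers)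
InF : ℕ → ℕ → ℕ → ℕ → ℕ → Set
InF δ C x a b = 1 ≤ a × a ≤ δ × 1 ≤ b × b ≤ δ × a + b + x + 1 ≡ C

-- t_M(x) = 2x-1 if x < M, 2(δ-x) if x > M  (value at x = M is irrelevant)
tM : ℕ → ℕ → ℕ → ℕ
tM δ M x with x <ᵇ M
... | Data.Bool.true = 2 * x ∸ 1
... | Data.Bool.false = 2 * (δ ∸ x)

-- For x < M an element of F^C_x forces C = a + b + x + 1 ≤ 2δ + M. In Case (III) with C' > C + 1
-- we have C ≥ 2δ + K₂ ≥ 2δ + M, so this is only possible when M = K₂ and C = 2δ + K₂, which the
-- magic parameter excludes. Case (IIA) contradicts C' > C + 1. In Case (IIB) we get M = K₁ = K₂,
-- 2δ = 3M + 1 and C = 4M + 1 = 2δ + M, so the bound forces x = M - 1 and a = b = δ; parity and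
-- δ ≥ 3 give M ≥ 3, and then t_M(M - 1) = 2M - 3 exceeds both 2a - 1 (a < M - 1) and
-- 2(δ - a) ≤ M - 1 (a > M).
module Submission where

open import Defs
open import Data.Bool using (true; false; T)
open import Data.Nat using (ℕ; suc; _+_; _*_; _∸_; _≤_; _<_; z≤n; s≤s; _<ᵇ_; _≤?_)
open import Data.Nat.Properties
open import Data.Nat.Tactic.RingSolver using (solve-∀)
open import Data.Product using (_×_; _,_)
open import Data.Sum using (_⊎_; inj₁; inj₂)
open import Relation.Binary using (tri<; tri≈; tri>)
open import Relation.Nullary using (¬_; contradiction)
open import Relation.Nullary.Decidable using (from-no)
open import Relation.Binary.PropositionalEquality using (_≡_; _≢_; refl; sym; trans; cong; subst; module ≡-Reasoning)

tM-< : ∀ δ {M x} → x < M → tM δ M x ≡ 2 * x ∸ 1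
tM-< δ {M} {x} x<M with x <ᵇ M | <⇒<ᵇ x<M
... | true | _ = refl

tM-≥ : ∀ δ {M x} → M ≤ x → tM δ M x ≡ 2 * (δ ∸ x)
tM-≥ δ {M} {x} M≤x with x <ᵇ M in eq
... | false = refl
... | true = contradiction M≤x (<⇒≱ (<ᵇ⇒< x M (subst T (sym eq) _)))

2*m≡m+m : ∀ m → 2 * m ≡ m + m
2*m≡m+m m = cong (m +_) (+-identityʳ m)

m<2*m∸1 : ∀ {m} → 2 ≤ m → m < 2 * m ∸ 1
m<2*m∸1 {m} 2≤m = begin-strict
  m             <⟨ m<m+n m (m<n⇒0<n∸m 2≤m) ⟩
  m + (m ∸ 1)   ≡⟨ sym (+-∸-assoc m (≤-trans (s≤s z≤n) 2≤m)) ⟩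
  m + m ∸ 1     ≡⟨ cong (_∸ 1) (sym (2*m≡m+m m)) ⟩
  2 * m ∸ 1     ∎
  where open ≤-Reasoning

m≡n∸1⇒n≡m+1 : ∀ {m n} → 1 ≤ n → m ≡ n ∸ 1 → n ≡ m + 1
m≡n∸1⇒n≡m+1 1≤n m≡n∸1 = trans (sym (m∸n+n≡m 1≤n)) (cong (_+ 1) (sym m≡n∸1))

+-maximal : ∀ {a b m n} → a ≤ m → b ≤ n → a + b ≡ m + n → a ≡ m × b ≡ n
+-maximal {a} {b} {m} {n} a≤m b≤n a+b≡m+n = a≡m , +-cancelˡ-≡ a b n (trans a+b≡m+n (cong (_+ n) (sym a≡m)))
  where
  a≡m : a ≡ m
  a≡m = ≤-antisym a≤m (+-cancelʳ-≤ n m a (subst (_≤ a + n) a+b≡m+n (+-monoʳ-≤ a b≤n)))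

InF-sum : ∀ {δ C x a b} → InF δ C x a b → C ≡ (a + b) + suc x
InF-sum {x = x} {a} {b} (_ , _ , _ , _ , refl) = reassoc a b x
  where
  reassoc : ∀ a b x → a + b + x + 1 ≡ (a + b) + suc x
  reassoc = solve-∀

InF⇒≤ : ∀ {δ C x a b} → InF δ C x a b → C ≤ 2 * δ + suc x
InF⇒≤ {δ} {x = x} {a} {b} inF@(_ , a≤δ , _ , b≤δ , _) =
  subst (_≤ 2 * δ + suc x) (sym (InF-sum inF))
    (+-monoˡ-≤ (suc x) (subst (a + b ≤_) (sym (2*m≡m+m δ)) (+-mono-≤ a≤δ b≤δ)))

InF-corner : ∀ {δ C x a b} → InF δ C x a b → C ≡ 2 * δ + suc x → a ≡ δ × b ≡ δ
InF-corner {δ} {x = x} {a} {b} inF@(_ , a≤δ , _ , b≤δ , _) C≡ =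
  +-maximal a≤δ b≤δ (+-cancelʳ-≡ (suc x) (a + b) (δ + δ) (begin
    a + b + suc x   ≡⟨ sym (InF-sum inF) ⟩
    _               ≡⟨ C≡ ⟩
    2 * δ + suc x   ≡⟨ cong (_+ suc x) (2*m≡m+m δ) ⟩
    δ + δ + suc x   ∎))
  where open ≡-Reasoning

fibre-empty-below-K₂ : ∀ {δ K₂ C M x a b} → 2 * δ + K₂ ≤ C → M ≤ K₂ →
  (C ≡ 2 * δ + K₂ → M < K₂) → x < M → ¬ InF δ C x a b
fibre-empty-below-K₂ {δ} {K₂} {C} {M} C≥ M≤K₂ tight⇒M<K₂ x<M inF = <-irrefl M≡K₂ (tight⇒M<K₂ C≡)
  where
  C≤ : C ≤ 2 * δ + M
  C≤ = ≤-trans (InF⇒≤ inF) (+-monoʳ-≤ (2 * δ) x<M)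
  M≡K₂ : M ≡ K₂
  M≡K₂ = ≤-antisym M≤K₂ (+-cancelˡ-≤ (2 * δ) K₂ M (≤-trans C≥ C≤))
  C≡ : C ≡ 2 * δ + K₂
  C≡ = ≤-antisym (subst (λ k → C ≤ 2 * δ + k) M≡K₂ C≤) C≥

tM-peak : ∀ δ m → 2 * (δ ∸ suc (suc m)) < 2 * m ∸ 1 →
  ∀ a → 1 ≤ a → a ≢ suc m → a ≢ m → tM δ (suc m) a < tM δ (suc m) m
tM-peak δ m right<peak a 1≤a a≢M a≢m with <-cmp a (suc m)
... | tri< a<M _ _ = begin-strict
  tM δ (suc m) a   ≡⟨ tM-< δ a<M ⟩
  2 * a ∸ 1        <⟨ ∸-monoˡ-< (*-monoʳ-< 2 (≤∧≢⇒< (m<1+n⇒m≤n a<M) a≢m)) (≤-trans 1≤a (m≤n*m a 2)) ⟩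
  2 * m ∸ 1        ≡⟨ sym (tM-< δ (n<1+n m)) ⟩
  tM δ (suc m) m   ∎
  where open ≤-Reasoning
... | tri≈ _ a≡M _ = contradiction a≡M a≢M
... | tri> _ _ M<a = begin-strict
  tM δ (suc m) a          ≡⟨ tM-≥ δ (<⇒≤ M<a) ⟩
  2 * (δ ∸ a)             ≤⟨ *-monoʳ-≤ 2 (∸-monoʳ-≤ δ M<a) ⟩
  2 * (δ ∸ suc (suc m))   <⟨ right<peak ⟩
  2 * m ∸ 1               ≡⟨ sym (tM-< δ (n<1+n m)) ⟩
  tM δ (suc m) m          ∎
  where open ≤-Reasoning

LowFibresAtCorner : ℕ → ℕ → ℕ → Set
LowFibresAtCorner δ C M =
  1 ≤ M ∸ 1 ×
  (∀ x a b → 1 ≤ x → x ≤ δ → x < M → InF δ C x a b → x ≡ M ∸ 1 × a ≡ δ × b ≡ δ) ×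
  InF δ C (M ∸ 1) δ δ ×
  (∀ a → 1 ≤ a → a ≤ δ → a ≢ M → a ≢ M ∸ 1 → tM δ M a < tM δ M (M ∸ 1))

lowFibresAtCorner : ∀ {δ C} m → 2 ≤ m → 1 ≤ δ → 2 * δ ≡ 3 * suc m + 1 →
  C ≡ 2 * suc m + 2 * suc m + 1 → LowFibresAtCorner δ C (suc m)
lowFibresAtCorner {δ} {C} m 2≤m 1≤δ 2δ≡ C≡4M+1 =
  ≤-trans (s≤s z≤n) 2≤m , onlyCorner , corner , λ a 1≤a _ → tM-peak δ m right<peak a 1≤a
  where
  open ≡-Reasoning
  C≡ : C ≡ 2 * δ + suc m
  C≡ = begin
    C                            ≡⟨ C≡4M+1 ⟩
    2 * suc m + 2 * suc m + 1    ≡⟨ split m ⟩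
    (3 * suc m + 1) + suc m      ≡⟨ cong (_+ suc m) (sym 2δ≡) ⟩
    2 * δ + suc m                ∎
    where
    split : ∀ m → 2 * suc m + 2 * suc m + 1 ≡ (3 * suc m + 1) + suc m
    split = solve-∀
  onlyCorner : ∀ x a b → 1 ≤ x → x ≤ δ → x < suc m → InF δ C x a b → x ≡ m × a ≡ δ × b ≡ δ
  onlyCorner x a b _ _ x<M inF = x≡m , InF-corner inF (trans C≡ (cong (λ k → 2 * δ + suc k) (sym x≡m)))
    where
    x≡m : x ≡ m
    x≡m = ≤-antisym (m<1+n⇒m≤n x<M)
      (≤-pred (+-cancelˡ-≤ (2 * δ) (suc m) (suc x) (subst (_≤ 2 * δ + suc x) C≡ (InF⇒≤ inF))))
  corner : InF δ C m δ δ
  corner = 1≤δ , ≤-refl , 1≤δ , ≤-refl , trans (sum δ m) (sym C≡)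
    where
    sum : ∀ d m → d + d + m + 1 ≡ 2 * d + suc m
    sum = solve-∀
  right<peak : 2 * (δ ∸ suc (suc m)) < 2 * m ∸ 1
  right<peak = subst (_< 2 * m ∸ 1) (sym right≡m) (m<2*m∸1 2≤m)
    where
    split : ∀ m → 3 * suc m + 1 ≡ m + 2 * (2 + m)
    split = solve-∀
    right≡m : 2 * (δ ∸ suc (suc m)) ≡ m
    right≡m = begin
      2 * (δ ∸ (2 + m))               ≡⟨ *-distribˡ-∸ 2 δ (2 + m) ⟩
      2 * δ ∸ 2 * (2 + m)             ≡⟨ cong (_∸ 2 * (2 + m)) (trans 2δ≡ (split m)) ⟩
      m + 2 * (2 + m) ∸ 2 * (2 + m)   ≡⟨ m+n∸n≡m m (2 * (2 + m)) ⟩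
      m                               ∎

3≤M : ∀ {δ} M → 3 ≤ δ → 2 * δ ≡ 3 * M + 1 → 3 ≤ M
3≤M 0 3≤δ 2δ≡ = contradiction (subst (6 ≤_) 2δ≡ (*-monoʳ-≤ 2 3≤δ)) (from-no (6 ≤? 1))
3≤M 1 3≤δ 2δ≡ = contradiction (subst (6 ≤_) 2δ≡ (*-monoʳ-≤ 2 3≤δ)) (from-no (6 ≤? 4))
3≤M {δ} 2 _ 2δ≡ = contradiction 2δ≡ (even≢odd δ 3)
3≤M (suc (suc (suc _))) _ _ = s≤s (s≤s (s≤s z≤n))

caseIIB-lowFibres : ∀ {δ C} M → 3 ≤ δ → 3 * M ≡ 2 * δ ∸ 1 → C ≡ 2 * M + 2 * M + 1 → LowFibresAtCorner δ C M
caseIIB-lowFibres {δ} M 3≤δ 3M≡ C≡ with m≡n∸1⇒n≡m+1 (≤-trans (s≤s z≤n) (≤-trans 3≤δ (m≤n*m δ 2))) 3M≡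
... | 2δ≡ with 3≤M M 3≤δ 2δ≡
... | s≤s 2≤m = lowFibresAtCorner _ 2≤m (≤-trans (s≤s z≤n) 3≤δ) 2δ≡ C≡

mainTheorem9 : (δ K₁ K₂ C₀ C₁ M : ℕ) →
    Admissible δ K₁ K₂ C₀ C₁ →
    Cmin C₀ C₁ + 1 < Cmax C₀ C₁ →
    MagicParameter δ K₁ K₂ C₀ C₁ M →
    (∀ x a b → 1 ≤ x → x ≤ δ → x < M → ¬ InF δ (Cmin C₀ C₁) x a b)
    ⊎
    (CaseIIB δ K₁ K₂ C₀ C₁ ×
     1 ≤ M ∸ 1 ×
     (∀ x a b → 1 ≤ x → x ≤ δ → x < M → InF δ (Cmin C₀ C₁) x a b →
        x ≡ M ∸ 1 × a ≡ δ × b ≡ δ) ×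
     InF δ (Cmin C₀ C₁) (M ∸ 1) δ δ ×
     (∀ a → 1 ≤ a → a ≤ δ → a ≢ M → a ≢ M ∸ 1 →
        tM δ M a < tM δ M (M ∸ 1)))
mainTheorem9 δ K₁ K₂ C₀ C₁ M (_ , inj₁ (inj₁ (_ , C'≡C+1))) C+1<C' _ =
  contradiction (sym C'≡C+1) (<⇒≢ C+1<C')
mainTheorem9 δ K₁ K₂ C₀ C₁ M ((3≤δ , _) , inj₁ (inj₂ iib@((_ , C≡ , _ , _) , _ , refl , 3K≡))) _
  ((K≤M , _ , M≤K , _) , _) with ≤-antisym K≤M M≤K
... | refl = inj₂ (iib , caseIIB-lowFibres M 3≤δ 3K≡ C≡)
mainTheorem9 δ K₁ K₂ C₀ C₁ M (_ , inj₂ iii@(_ , _ , _ , _ , C≥2δ+K₂)) C+1<C'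
  ((_ , _ , M≤K₂ , _) , _ , tight⇒M<K₂) =
  inj₁ λ _ _ _ _ _ x<M → fibre-empty-below-K₂ (C≥2δ+K₂ C+1<C') M≤K₂ (tight⇒M<K₂ iii C+1<C') x<M
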